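{- For every proposition $A$ and proof-terms $t_1,t_2$: if $t_1\in[\![A]\!]$ and $t_2\in[\![A]\!]$, then $t_1\parallel t_2\in[\![A]\!]$.
   Context: The $\odot$-calculus. Propositions: $A ::= \top \mid \bot \mid A \Rightarrow A \mid A \wedge A \mid A \vee A \mid A \odot A$. Proof-terms: $t ::= x \mid t \parallel u \mid * \mid \delta_\bot(t) \mid \lambda x\, t \mid t\,u \mid \langle t,u\rangle \mid \delta_\wedge(t,[x,y]u) \mid \mathrm{inl}(t) \mid \mathrm{inr}(t) \mid \delta_\vee(t,[x]u,[y]v) \mid t+u \mid \delta_\odot(t,[x]u,[y]v) \mid \delta_\odot^\parallel(t,[x]u,[y]v)$, where $\lambda x$ binds $x$, $[x,y]$ binds $x,y$, and $[x]$, $[y]$ bind $x$, $y$; $(u/x)t$ is capture-avoiding substitution. Ultra-reduction $\longrightarrow$ is the smallest contextual relation (closed under all term constructors) containing $\sigma l\to\sigma r$ for every substitution $\sigma$ and every rule $l\to r$ among: $(\lambda x\,t)\,u\to(u/x)t$; $\delta_\wedge(\langle t,u\rangle,[x,y]v)\to(t/x,u/y)v$; $\delta_\vee(\mathrm{inl}(t),[x]v,[y]w)\to(t/x)v$; $\delta_\vee(\mathrm{inr}(u),[x]v,[y]w)\to(u/y)w$; $\delta_\odot(t+u,[x]v,[y]w)\to(t/x)v$; $\delta_\odot(t+u,[x]v,[y]w)\to(u/y)w$; $\delta_\odot^\parallel(t+u,[x]v,[y]w)\to(t/x)v\parallel(u/y)w$; $(\lambda x\,t)\parallel(\lambda x\,u)\to\lambda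 x\,(t\parallel u)$; $\langle t,u\rangle\parallel\langle v,w\rangle\to\langle t\parallel v,u\parallel w\rangle$; $\delta_\vee(t\parallel u,[x]v,[y]w)\to\delta_\vee(t,[x]v,[y]w)\parallel\delta_\vee(u,[x]v,[y]w)$; $(t+u)\parallel(v+w)\to(t\parallel v)+(u\parallel w)$; $t\parallel t\to t$; $t\parallel u\to t$; $t\parallel u\to u$. $\longrightarrow^*$ is its reflexive-transitive closure; $t$ strongly terminates if there is no infinite ultra-reduction sequence from $t$. Sets $[\![A]\!]$ are defined by induction on $A$: $t\in[\![\top]\!]$ and $t\in[\![\bot]\!]$ iff $t$ strongly terminates; $t\in[\![A\Rightarrow B]\!]$ iff $t$ strongly terminates and whenever $t\longrightarrow^*\lambda x\,u$, then $(v/x)u\in[\![B]\!]$ for every $v\in[\![A]\!]$; $t\in[\![A\wedge B]\!]$ iff $t$ strongly terminates and whenever $t\longrightarrow^*\langle u,v\rangle$, then $u\in[\![A]\!]$ and $v\in[\![B]\!]$; $t\in[\![A\vee B]\!]$ iff $t$ strongly terminates, whenever $t\longrightarrow^*\mathrm{inl}(u)$ then $u\in[\![A]\!]$, and whenever $t\longrightarrow^*\mathrm{inr}(v)$ then $v\in[\![B]\!]$; $t\in[\![A\odot B]\!]$ iff $t$ strongly terminates and whenever $t\longrightarrow^* u+v$, then $u\in[\![A]\!]$ and $v\in[\![B]\!]$. -}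

module Defs where

open import Data.Nat using (ℕ; zero; suc)
open import Data.Product using (_×_)
open import Induction.WellFounded using (Acc)
open import Relation.Binary.Construct.Closure.ReflexiveTransitive using (Star)

data Prop : Set where
  ⊤′ ⊥′ : Prop
  _⇒_ _∧_ _∨_ _⊙_ : Prop → Prop → Prop

-- Proof-terms, with de Bruijn indices for bound variables (terms up to α-equivalence).
-- Binding conventions:
--   lam t            : t under 1 binder (x = index 0)
--   δ∧ t u           : u under 2 binders, [x,y]u with x = index 1, y = index 0
--   δ∨ t u v, δ⊙ t u v, δ⊙∥ t u v : u and v each under 1 binder
data Term : Set where
  var  : ℕ → Term
  _∥_  : Term → Term → Term
  star : Term
  δ⊥   : Term → Term
  lam  : Term → Term
  app  : Term → Term → Term
  pair : Term → Term → Term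
  δ∧   : Term → Term → Term
  inl  : Term → Term
  inr  : Term → Term
  δ∨   : Term → Term → Term → Term
  _⊕_  : Term → Term → Term
  δ⊙   : Term → Term → Term → Term
  δ⊙∥  : Term → Term → Term → Term

Ren : Set
Ren = ℕ → ℕ

liftR : Ren → Ren
liftR ρ zero    = zero
liftR ρ (suc n) = suc (ρ n)

rename : Ren → Term → Term
rename ρ (var n)      = var (ρ n)
rename ρ (t ∥ u)      = rename ρ t ∥ rename ρ u
rename ρ star         = star
rename ρ (δ⊥ t)       = δ⊥ (rename ρ t)
rename ρ (lam t)      = lam (rename (liftR ρ) t)
rename ρ (app t u)    = app (rename ρ t) (rename ρ u)
rename ρ (pair t u)   = pair (rename ρ t) (rename ρ u)
rename ρ (δ∧ t u)     = δ∧ (rename ρ t) (rename (liftR (liftR ρ)) u)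
rename ρ (inl t)      = inl (rename ρ t)
rename ρ (inr t)      = inr (rename ρ t)
rename ρ (δ∨ t u v)   = δ∨ (rename ρ t) (rename (liftR ρ) u) (rename (liftR ρ) v)
rename ρ (t ⊕ u)      = rename ρ t ⊕ rename ρ u
rename ρ (δ⊙ t u v)   = δ⊙ (rename ρ t) (rename (liftR ρ) u) (rename (liftR ρ) v)
rename ρ (δ⊙∥ t u v)  = δ⊙∥ (rename ρ t) (rename (liftR ρ) u) (rename (liftR ρ) v)

Sub : Set
Sub = ℕ → Term

liftS : Sub → Sub
liftS σ zero    = var zero
liftS σ (suc n) = rename suc (σ n)

subst : Sub → Term → Term
subst σ (var n)      = σ n
subst σ (t ∥ u)      = subst σ t ∥ subst σ u
subst σ star         = star
subst σ (δ⊥ t)       = δ⊥ (subst σ t)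
subst σ (lam t)      = lam (subst (liftS σ) t)
subst σ (app t u)    = app (subst σ t) (subst σ u)
subst σ (pair t u)   = pair (subst σ t) (subst σ u)
subst σ (δ∧ t u)     = δ∧ (subst σ t) (subst (liftS (liftS σ)) u)
subst σ (inl t)      = inl (subst σ t)
subst σ (inr t)      = inr (subst σ t)
subst σ (δ∨ t u v)   = δ∨ (subst σ t) (subst (liftS σ) u) (subst (liftS σ) v)
subst σ (t ⊕ u)      = subst σ t ⊕ subst σ u
subst σ (δ⊙ t u v)   = δ⊙ (subst σ t) (subst (liftS σ) u) (subst (liftS σ) v)
subst σ (δ⊙∥ t u v)  = δ⊙∥ (subst σ t) (subst (liftS σ) u) (subst (liftS σ) v)

sub1 : Term → Sub
sub1 u zero    = u
sub1 u (suc n) = var n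

_[_] : Term → Term → Term
t [ u ] = subst (sub1 u) t

sub2 : Term → Term → Sub
sub2 t u zero          = u
sub2 t u (suc zero)    = t
sub2 t u (suc (suc n)) = var n

infix 4 _⟶_
data _⟶_ : Term → Term → Set where
  β        : ∀ {t u} → app (lam t) u ⟶ t [ u ]
  β∧       : ∀ {t u v} → δ∧ (pair t u) v ⟶ subst (sub2 t u) v
  β∨l      : ∀ {t v w} → δ∨ (inl t) v w ⟶ v [ t ]
  β∨r      : ∀ {u v w} → δ∨ (inr u) v w ⟶ w [ u ]
  β⊙l      : ∀ {t u v w} → δ⊙ (t ⊕ u) v w ⟶ v [ t ]
  β⊙r      : ∀ {t u v w} → δ⊙ (t ⊕ u) v w ⟶ w [ u ]
  β⊙∥      : ∀ {t u v w} → δ⊙∥ (t ⊕ u) v w ⟶ (v [ t ]) ∥ (w [ u ])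
  ∥lam     : ∀ {t u} → lam t ∥ lam u ⟶ lam (t ∥ u)
  ∥pair    : ∀ {t u v w} → pair t u ∥ pair v w ⟶ pair (t ∥ v) (u ∥ w)
  δ∨∥      : ∀ {t u v w} → δ∨ (t ∥ u) v w ⟶ δ∨ t v w ∥ δ∨ u v w
  ∥⊕       : ∀ {t u v w} → (t ⊕ u) ∥ (v ⊕ w) ⟶ (t ∥ v) ⊕ (u ∥ w)
  ∥idem    : ∀ {t} → t ∥ t ⟶ t
  ∥projl   : ∀ {t u} → t ∥ u ⟶ t
  ∥projr   : ∀ {t u} → t ∥ u ⟶ u
  ∥₁   : ∀ {t t′ u} → t ⟶ t′ → t ∥ u ⟶ t′ ∥ u
  ∥₂   : ∀ {t u u′} → u ⟶ u′ → t ∥ u ⟶ t ∥ u′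
  δ⊥₁  : ∀ {t t′} → t ⟶ t′ → δ⊥ t ⟶ δ⊥ t′
  lam₁ : ∀ {t t′} → t ⟶ t′ → lam t ⟶ lam t′
  app₁ : ∀ {t t′ u} → t ⟶ t′ → app t u ⟶ app t′ u
  app₂ : ∀ {t u u′} → u ⟶ u′ → app t u ⟶ app t u′
  pair₁ : ∀ {t t′ u} → t ⟶ t′ → pair t u ⟶ pair t′ u
  pair₂ : ∀ {t u u′} → u ⟶ u′ → pair t u ⟶ pair t u′
  δ∧₁  : ∀ {t t′ u} → t ⟶ t′ → δ∧ t u ⟶ δ∧ t′ u
  δ∧₂  : ∀ {t u u′} → u ⟶ u′ → δ∧ t u ⟶ δ∧ t u′
  inl₁ : ∀ {t t′} → t ⟶ t′ → inl t ⟶ inl t′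
  inr₁ : ∀ {t t′} → t ⟶ t′ → inr t ⟶ inr t′
  δ∨₁  : ∀ {t t′ u v} → t ⟶ t′ → δ∨ t u v ⟶ δ∨ t′ u v
  δ∨₂  : ∀ {t u u′ v} → u ⟶ u′ → δ∨ t u v ⟶ δ∨ t u′ v
  δ∨₃  : ∀ {t u v v′} → v ⟶ v′ → δ∨ t u v ⟶ δ∨ t u v′
  ⊕₁   : ∀ {t t′ u} → t ⟶ t′ → t ⊕ u ⟶ t′ ⊕ u
  ⊕₂   : ∀ {t u u′} → u ⟶ u′ → t ⊕ u ⟶ t ⊕ u′
  δ⊙₁  : ∀ {t t′ u v} → t ⟶ t′ → δ⊙ t u v ⟶ δ⊙ t′ u v
  δ⊙₂  : ∀ {t u u′ v} → u ⟶ u′ → δ⊙ t u v ⟶ δ⊙ t u′ v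
  δ⊙₃  : ∀ {t u v v′} → v ⟶ v′ → δ⊙ t u v ⟶ δ⊙ t u v′
  δ⊙∥₁ : ∀ {t t′ u v} → t ⟶ t′ → δ⊙∥ t u v ⟶ δ⊙∥ t′ u v
  δ⊙∥₂ : ∀ {t u u′ v} → u ⟶ u′ → δ⊙∥ t u v ⟶ δ⊙∥ t u′ v
  δ⊙∥₃ : ∀ {t u v v′} → v ⟶ v′ → δ⊙∥ t u v ⟶ δ⊙∥ t u v′

infix 4 _⟶*_
_⟶*_ : Term → Term → Set
_⟶*_ = Star _⟶_

_⟵_ : Term → Term → Set
u ⟵ t = t ⟶ u

SN : Term → Set
SN t = Acc _⟵_ t

⟦_⟧ : Prop → Term → Set
⟦ ⊤′ ⟧ t = SN t
⟦ ⊥′ ⟧ t = SN t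
⟦ A ⇒ B ⟧ t = SN t × (∀ u → t ⟶* lam u → ∀ v → ⟦ A ⟧ v → ⟦ B ⟧ (u [ v ]))
⟦ A ∧ B ⟧ t = SN t × (∀ u v → t ⟶* pair u v → ⟦ A ⟧ u × ⟦ B ⟧ v)
⟦ A ∨ B ⟧ t = SN t × (∀ u → t ⟶* inl u → ⟦ A ⟧ u) × (∀ v → t ⟶* inr v → ⟦ B ⟧ v)
⟦ A ⊙ B ⟧ t = SN t × (∀ u v → t ⟶* (u ⊕ v) → ⟦ A ⟧ u × ⟦ B ⟧ v)

-- Pushing ∥ through matching λs, pairs and sums turns t ∥ u into a "merge" of t and u.
-- Every reduct of a merge is again a merge: of a reduct of t, of a reduct of u, or of t
-- and u themselves with less structure left to distribute. Hence merges of strongly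
-- terminating terms strongly terminate, and a merge reducing to a λ, a pair or a sum is
-- built from merges of the components of reducts of t and u, so induction on A carries
-- membership in ⟦ A ⟧ from t and u to every merge, in particular to t ∥ u.
module Submission where

open import Defs
open import Data.Nat using (ℕ; suc; _+_; _<_; s≤s; z≤n)
open import Data.Nat.Properties using (n<1+n; +-monoˡ-<; +-monoʳ-<)
open import Data.Nat.Induction using (<-wellFounded)
open import Data.Product using (_×_; _,_; proj₁; proj₂)
open import Induction.WellFounded using (Acc; acc)
open import Relation.Binary.Construct.Closure.ReflexiveTransitive using (ε; _◅_)

-- Only the constructors that ∥ distributes over count; any other subterm is a leaf.
size : Term → ℕ
branchSize : Term → ℕ

size t = suc (branchSize t)

branchSize (lam t)    = size t
branchSize (pair t u) = size t + size u
branchSize (t ⊕ u)    = size t + size u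
branchSize _          = 0

data Merge : Term → Term → Term → Set where
  left  : ∀ {t u} → Merge t u t
  right : ∀ {t u} → Merge t u u
  par   : ∀ {t u} → Merge t u (t ∥ u)
  lam   : ∀ {t u s} → Merge t u s → Merge (lam t) (lam u) (lam s)
  pair  : ∀ {t₁ t₂ u₁ u₂ s₁ s₂} →
          Merge t₁ u₁ s₁ → Merge t₂ u₂ s₂ → Merge (pair t₁ t₂) (pair u₁ u₂) (pair s₁ s₂)
  _⊕_   : ∀ {t₁ t₂ u₁ u₂ s₁ s₂} →
          Merge t₁ u₁ s₁ → Merge t₂ u₂ s₂ → Merge (t₁ ⊕ t₂) (u₁ ⊕ u₂) (s₁ ⊕ s₂)

weight : ∀ {t u s} → Merge t u s → ℕ
weight left        = 0
weight right       = 0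
weight (par {t})   = size t
weight (lam c)     = weight c
weight (pair c d)  = weight c + weight d
weight (c ⊕ d)     = weight c + weight d

Merge-subst : ∀ σ {t u s} → Merge t u s → Merge (subst σ t) (subst σ u) (subst σ s)
Merge-subst σ left       = left
Merge-subst σ right      = right
Merge-subst σ par        = par
Merge-subst σ (lam c)    = lam (Merge-subst (liftS σ) c)
Merge-subst σ (pair c d) = pair (Merge-subst σ c) (Merge-subst σ d)
Merge-subst σ (c ⊕ d)    = Merge-subst σ c ⊕ Merge-subst σ d

data MergeStep {t u s : Term} (c : Merge t u s) (s′ : Term) : Set where
  reduceLeft  : ∀ {t′} → t ⟶ t′ → Merge t′ u s′ → MergeStep c s′
  reduceRight : ∀ {u′} → u ⟶ u′ → Merge t u′ s′ → MergeStep c s′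
  shrink      : (c′ : Merge t u s′) → weight c′ < weight c → MergeStep c s′

par-step : ∀ {t u s′} → t ∥ u ⟶ s′ → MergeStep (par {t} {u}) s′
par-step (∥lam {t})      = shrink (lam par) (n<1+n (size t))
par-step (∥pair {t} {u}) = shrink (pair par par) (n<1+n (size t + size u))
par-step (∥⊕ {t} {u})    = shrink (par ⊕ par) (n<1+n (size t + size u))
par-step ∥idem           = shrink left (s≤s z≤n)
par-step ∥projl          = shrink left (s≤s z≤n)
par-step ∥projr          = shrink right (s≤s z≤n)
par-step (∥₁ r)          = reduceLeft r par
par-step (∥₂ r)          = reduceRight r par

merge-step : ∀ {t u s s′} (c : Merge t u s) → s ⟶ s′ → MergeStep c s′
merge-step left r  = reduceLeft r left
merge-step right r = reduceRight r right
merge-step par r   = par-step r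
merge-step (lam c) (lam₁ r) with merge-step c r
... | reduceLeft r′ c′  = reduceLeft (lam₁ r′) (lam c′)
... | reduceRight r′ c′ = reduceRight (lam₁ r′) (lam c′)
... | shrink c′ lt      = shrink (lam c′) lt
merge-step (pair c d) (pair₁ r) with merge-step c r
... | reduceLeft r′ c′  = reduceLeft (pair₁ r′) (pair c′ d)
... | reduceRight r′ c′ = reduceRight (pair₁ r′) (pair c′ d)
... | shrink c′ lt      = shrink (pair c′ d) (+-monoˡ-< (weight d) lt)
merge-step (pair c d) (pair₂ r) with merge-step d r
... | reduceLeft r′ d′  = reduceLeft (pair₂ r′) (pair c d′)
... | reduceRight r′ d′ = reduceRight (pair₂ r′) (pair c d′)
... | shrink d′ lt      = shrink (pair c d′) (+-monoʳ-< (weight c) lt)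
merge-step (c ⊕ d) (⊕₁ r) with merge-step c r
... | reduceLeft r′ c′  = reduceLeft (⊕₁ r′) (c′ ⊕ d)
... | reduceRight r′ c′ = reduceRight (⊕₁ r′) (c′ ⊕ d)
... | shrink c′ lt      = shrink (c′ ⊕ d) (+-monoˡ-< (weight d) lt)
merge-step (c ⊕ d) (⊕₂ r) with merge-step d r
... | reduceLeft r′ d′  = reduceLeft (⊕₂ r′) (c ⊕ d′)
... | reduceRight r′ d′ = reduceRight (⊕₂ r′) (c ⊕ d′)
... | shrink d′ lt      = shrink (c ⊕ d′) (+-monoʳ-< (weight c) lt)

merge-SN-acc : ∀ {t u s} → SN t → SN u → (c : Merge t u s) → Acc _<_ (weight c) → SN s
MergeStep-SN : ∀ {t u s s′} {c : Merge t u s} →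
               SN t → SN u → Acc _<_ (weight c) → MergeStep c s′ → SN s′

merge-SN-acc snt snu c wc = acc (λ r → MergeStep-SN snt snu wc (merge-step c r))

MergeStep-SN (acc rt) snu _ (reduceLeft r c′)  = merge-SN-acc (rt r) snu c′ (<-wellFounded _)
MergeStep-SN snt (acc ru) _ (reduceRight r c′) = merge-SN-acc snt (ru r) c′ (<-wellFounded _)
MergeStep-SN snt snu (acc rw) (shrink c′ lt)   = merge-SN-acc snt snu c′ (rw lt)

merge-SN : ∀ {t u s} → SN t → SN u → Merge t u s → SN s
merge-SN snt snu c = merge-SN-acc snt snu c (<-wellFounded _)

data MergeOfReducts (t u s : Term) : Set where
  reducts : ∀ {t′ u′} → t ⟶* t′ → u ⟶* u′ → Merge t′ u′ s → MergeOfReducts t u s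

merge-⟶* : ∀ {t u s s′} → Merge t u s → s ⟶* s′ → MergeOfReducts t u s′
merge-⟶* c ε = reducts ε ε c
merge-⟶* c (r ◅ rs) with merge-step c r
... | reduceLeft r′ c′ with merge-⟶* c′ rs
...   | reducts ts us c″ = reducts (r′ ◅ ts) us c″
merge-⟶* c (r ◅ rs) | reduceRight r′ c′ with merge-⟶* c′ rs
...   | reducts ts us c″ = reducts ts (r′ ◅ us) c″
merge-⟶* c (r ◅ rs) | shrink c′ _ = merge-⟶* c′ rs

⟦⟧⇒SN : ∀ A {t} → ⟦ A ⟧ t → SN t
⟦⟧⇒SN ⊤′ h      = h
⟦⟧⇒SN ⊥′ h      = h
⟦⟧⇒SN (A ⇒ B) h = proj₁ h
⟦⟧⇒SN (A ∧ B) h = proj₁ h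
⟦⟧⇒SN (A ∨ B) h = proj₁ h
⟦⟧⇒SN (A ⊙ B) h = proj₁ h

⟦⟧-merge : ∀ A {t u s} → ⟦ A ⟧ t → ⟦ A ⟧ u → Merge t u s → ⟦ A ⟧ s
⟦⟧-merge ⊤′ ht hu c = merge-SN ht hu c
⟦⟧-merge ⊥′ ht hu c = merge-SN ht hu c
⟦⟧-merge (A ⇒ B) (snt , ht) (snu , hu) c = merge-SN snt snu c , at-lam
  where
  at-lam : ∀ w → _ ⟶* lam w → ∀ v → ⟦ A ⟧ v → ⟦ B ⟧ (w [ v ])
  at-lam w rs v hv with merge-⟶* c rs
  ... | reducts ts us left    = ht w ts v hv
  ... | reducts ts us right   = hu w us v hv
  ... | reducts ts us (lam c′) =
    ⟦⟧-merge B (ht _ ts v hv) (hu _ us v hv) (Merge-subst (sub1 v) c′)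
⟦⟧-merge (A ∧ B) (snt , ht) (snu , hu) c = merge-SN snt snu c , at-pair
  where
  at-pair : ∀ w₁ w₂ → _ ⟶* pair w₁ w₂ → ⟦ A ⟧ w₁ × ⟦ B ⟧ w₂
  at-pair w₁ w₂ rs with merge-⟶* c rs
  ... | reducts ts us left          = ht w₁ w₂ ts
  ... | reducts ts us right         = hu w₁ w₂ us
  ... | reducts ts us (pair c₁ c₂) with ht _ _ ts | hu _ _ us
  ...   | htA , htB | huA , huB = ⟦⟧-merge A htA huA c₁ , ⟦⟧-merge B htB huB c₂
⟦⟧-merge (A ∨ B) (snt , htl , htr) (snu , hul , hur) c = merge-SN snt snu c , at-inl , at-inr
  where
  at-inl : ∀ w → _ ⟶* inl w → ⟦ A ⟧ w
  at-inl w rs with merge-⟶* c rs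
  ... | reducts ts us left  = htl w ts
  ... | reducts ts us right = hul w us
  at-inr : ∀ w → _ ⟶* inr w → ⟦ B ⟧ w
  at-inr w rs with merge-⟶* c rs
  ... | reducts ts us left  = htr w ts
  ... | reducts ts us right = hur w us
⟦⟧-merge (A ⊙ B) (snt , ht) (snu , hu) c = merge-SN snt snu c , at-sum
  where
  at-sum : ∀ w₁ w₂ → _ ⟶* (w₁ ⊕ w₂) → ⟦ A ⟧ w₁ × ⟦ B ⟧ w₂
  at-sum w₁ w₂ rs with merge-⟶* c rs
  ... | reducts ts us left        = ht w₁ w₂ ts
  ... | reducts ts us right       = hu w₁ w₂ us
  ... | reducts ts us (c₁ ⊕ c₂) with ht _ _ ts | hu _ _ us
  ...   | htA , htB | huA , huB = ⟦⟧-merge A htA huA c₁ , ⟦⟧-merge B htB huB c₂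

mainTheorem8 : (A : Prop) (t₁ t₂ : Term) → ⟦ A ⟧ t₁ → ⟦ A ⟧ t₂ → ⟦ A ⟧ (t₁ ∥ t₂)
mainTheorem8 A t₁ t₂ h₁ h₂ = ⟦⟧-merge A h₁ h₂ par
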